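{- Let $\alpha$ be a real quadratic irrational number with simple continued fraction expansion $\alpha=[a_0;a_1,\ldots,a_{r-1},\overline{b_0,\ldots,b_{s-1}}]$, $r\geq 0$, $s\geq 1$, and let $(q_{\alpha,i})_{i\geq 0}$ be its sequence of convergent denominators. Let \[ t_{\alpha}=\operatorname{trace}\left(\prod_{0\leq j<s}\begin{pmatrix} b_j & 1\\ 1 & 0\end{pmatrix}\right). \] For $j=0,\ldots,s-1$ let $q^{(j)}_{\alpha,i}=q_{\alpha,si+j+r}$ for $i\geq 0$. Define \[ \theta_{\alpha,1}=\frac{t_{\alpha}+\sqrt{t_{\alpha}^2-4(-1)^s}}{2},\qquad \theta_{\alpha,2}=\frac{t_{\alpha}-\sqrt{t_{\alpha}^2-4(-1)^s}}{2}, \] \[ c^{(j)}_{\alpha,1}=\frac{q^{(j)}_{\alpha,1}-\theta_{\alpha,2}q^{(j)}_{\alpha,0}}{\theta_{\alpha,1}-\theta_{\alpha,2}},\qquad c^{(j)}_{\alpha,2}=\frac{q^{(j)}_{\alpha,1}-\theta_{\alpha,1}q^{(j)}_{\alpha,0}}{\theta_{\alpha,1}-\theta_{\alpha,2}}. \] Then for every $j\in\{0,\ldots,s-1\}$ and every $i\geq 0$, \[ q^{(j)}_{\alpha,i}=c^{(j)}_{\alpha,1}\theta_{\alpha,1}^{i}-c^{(j)}_{\alpha,2}\theta_{\alpha,2}^{i}, \] and $c^{(j)}_{\alpha,1}>0$.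
   Context: For a simple continued fraction $[c_0;c_1,c_2,\ldots]$, the convergent denominators are defined by $q_{ -1}=0$, $q_0=1$, $q_n=c_nq_{n-1}+q_{n-2}$ for $n\geq 1$. The overline denotes the periodic part of the expansion. -}

module Defs where

open import Data.Nat as ℕ using (ℕ; zero; suc)
open import Data.Integer as ℤ using (ℤ; +_)
open import Data.Rational as ℚ using (ℚ; 0ℚ; 1ℚ)
open import Data.Rational.Properties as ℚP using ()
open import Data.Fin using (Fin; zero; suc)
open import Data.Product using (_×_; _,_; proj₁; proj₂)
open import Data.Sum using (_⊎_)
open import Relation.Nullary using (yes; no)

-- Convergent denominators of [c₀; c₁, c₂, …]:
-- q₋₁ = 0, q₀ = 1, qₙ = cₙ qₙ₋₁ + qₙ₋₂.
-- qPair c n = (qₙ₋₁ , qₙ).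

qPair : (ℕ → ℤ) → ℕ → ℤ × ℤ
qPair c zero = (+ 0 , + 1)
qPair c (suc n) with qPair c n
... | (qm , qn) = (qn , c (suc n) ℤ.* qn ℤ.+ qm)

convDen : (ℕ → ℤ) → ℕ → ℤ
convDen c n = proj₂ (qPair c n)

Mat2 : Set
Mat2 = Fin 2 → Fin 2 → ℤ

mmul : Mat2 → Mat2 → Mat2
mmul A B i k = A i zero ℤ.* B zero k ℤ.+ A i (suc zero) ℤ.* B (suc zero) k

idM : Mat2
idM zero zero = + 1
idM (suc zero) (suc zero) = + 1
idM _ _ = + 0

cfM : ℤ → Mat2
cfM b zero zero = b
cfM b (suc zero) (suc zero) = + 0
cfM b _ _ = + 1

trace : Mat2 → ℤ
trace A = A zero zero ℤ.+ A (suc zero) (suc zero)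

prodM : (ℕ → ℤ) → ℕ → Mat2
prodM b zero = idM
prodM b (suc k) = mmul (prodM b k) (cfM (b k))

-- The real quadratic field ℚ(√D), D ≥ 0 a rational, elements x + y√D
-- represented as pairs (x , y), √D the nonnegative real square root.

QD : Set
QD = ℚ × ℚ

module _ (D : ℚ) where

  emb : ℚ → QD
  emb x = (x , 0ℚ)

  embℤ : ℤ → QD
  embℤ n = emb (n ℚ./ 1)

  _⊕_ : QD → QD → QD
  (a , b) ⊕ (c , d) = (a ℚ.+ c , b ℚ.+ d)

  _⊖_ : QD → QD → QD
  (a , b) ⊖ (c , d) = (a ℚ.- c , b ℚ.- d)

  _⊗_ : QD → QD → QD
  (a , b) ⊗ (c , d) = (a ℚ.* c ℚ.+ (b ℚ.* d) ℚ.* D , a ℚ.* d ℚ.+ b ℚ.* c)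

  _^^_ : QD → ℕ → QD
  x ^^ zero = (1ℚ , 0ℚ)
  x ^^ suc n = x ⊗ (x ^^ n)

  sqrtD : QD
  sqrtD = (0ℚ , 1ℚ)

  -- rational inverse, with the (irrelevant) convention 0⁻¹ = 0
  invℚ : ℚ → ℚ
  invℚ p with p ℚP.≟ 0ℚ
  ... | yes _ = 0ℚ
  ... | no p≢0 = ℚ.1/_ p {{ℚ.≢-nonZero p≢0}}

  -- (x + y√D)⁻¹ = (x − y√D) / (x² − y² D)   (convention: 0 if the norm is 0)
  inv : QD → QD
  inv (x , y) = let n = invℚ (x ℚ.* x ℚ.- (y ℚ.* y) ℚ.* D)
                in (x ℚ.* n , ℚ.- (y ℚ.* n))

  _⊘_ : QD → QD → QD
  u ⊘ v = u ⊗ inv v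

  -- x + y√D > 0 as a real number (for D ≥ 0), by sign cases
  Positive : QD → Set
  Positive (x , y) =
      (0ℚ ℚ.≤ x × 0ℚ ℚ.≤ y × (0ℚ ℚ.< x ⊎ 0ℚ ℚ.< y))
    ⊎ (0ℚ ℚ.< x × y ℚ.< 0ℚ × (y ℚ.* y) ℚ.* D ℚ.< x ℚ.* x)
    ⊎ (x ℚ.< 0ℚ × 0ℚ ℚ.< y × x ℚ.* x ℚ.< (y ℚ.* y) ℚ.* D)

-- Data attached to an eventually periodic expansion
-- [c₀; c₁, …, c_{r-1}, overline{b₀,…,b_{s-1}}] with b_j = c_{r+j}.

module _ (c : ℕ → ℤ) (r s : ℕ) where

  b : ℕ → ℤ
  b j = c (r ℕ.+ j)

  tα : ℤ
  tα = trace (prodM b s)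

  Dα : ℚ
  Dα = (tα ℤ.* tα ℤ.- + 4 ℤ.* (ℤ.- + 1) ℤ.^ s) ℚ./ 1

  θ₁ : QD
  θ₁ = (tα ℚ./ 2 , + 1 ℚ./ 2)

  θ₂ : QD
  θ₂ = (tα ℚ./ 2 , ℤ.- (+ 1) ℚ./ 2)

  qj : ℕ → ℕ → ℤ
  qj j i = convDen c (s ℕ.* i ℕ.+ j ℕ.+ r)

  c₁ : ℕ → QD
  c₁ j = _⊘_ Dα (_⊖_ Dα (embℤ Dα (qj j 1)) (_⊗_ Dα θ₂ (embℤ Dα (qj j 0))))
                (_⊖_ Dα θ₁ θ₂)

  c₂ : ℕ → QD
  c₂ j = _⊘_ Dα (_⊖_ Dα (embℤ Dα (qj j 1)) (_⊗_ Dα θ₁ (embℤ Dα (qj j 0))))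
                (_⊖_ Dα θ₁ θ₂)

{-# OPTIONS --safe #-}

-- Write X for the product of the matrices (bⱼ 1; 1 0) over one period.  The convergent
-- denominators are entries of products of the matrices (cᵢ 1; 1 0), and for n ≥ r the block
-- of s consecutive factors starting after n has the same trace t as X (cyclic invariance) and
-- determinant (−1)ˢ, so Cayley–Hamilton gives q(n+2s) = t q(n+s) − (−1)ˢ q(n).  Each q⁽ʲ⁾ thus
-- satisfies a second-order recurrence with characteristic roots θ₁, θ₂, and Binet's formula holds
-- in any commutative ring in which θ₁ − θ₂ is invertible; here θ₁ − θ₂ = √D in ℚ(√D), where
-- D = t² − 4(−1)ˢ = (a − d)² + 4bc > 0 for X = (a b; c d).  Finally c₁ √D = q₁ − θ₂ q₀ gives
-- c₁ = q₀/2 + (2q₁ − t q₀)/(2D) √D, which is positive because q₀ ≥ 1 and, when 2q₁ < t q₀,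
-- (2q₁ − t q₀)² < q₀² D.

module Submission where

open import Defs
open import Level using (0ℓ)
open import Algebra using (CommutativeRing; Semiring)
open import Data.Nat as ℕ using (ℕ; zero; suc; _≤_; _<_)
import Data.Nat.Properties as ℕP
open import Data.Nat.Coprimality as Coprime using ()
open import Data.Integer as ℤ using (ℤ; +_; +[1+_]; -[1+_])
import Data.Integer.Properties as ℤP
open import Data.Rational as ℚ using (ℚ; mkℚ; 0ℚ; 1ℚ; ½)
import Data.Rational.Properties as ℚP
open import Data.Fin.Patterns using (0F; 1F)
open import Data.Product using (_×_; _,_; proj₁; proj₂)
open import Data.Sum using (_⊎_; inj₁; inj₂)
open import Data.List using (_∷_; [])
open import Algebra.Definitions
  using (Associative; Commutative; LeftIdentity; RightIdentity; _DistributesOverˡ_; _DistributesOverʳ_)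
open import Relation.Nullary using (yes; no; contradiction)
open import Relation.Nullary.Decidable using (dec⇒maybe)
open import Relation.Binary.PropositionalEquality
  using (_≡_; _≢_; refl; sym; trans; cong; cong₂; subst; subst₂; isEquivalence; module ≡-Reasoning)
open import Tactic.RingSolver using (solve-∀; solve)
open import Tactic.RingSolver.Core.AlmostCommutativeRing
  using (AlmostCommutativeRing; fromCommutativeRing)
open import Data.Nat.Tactic.RingSolver using () renaming (ring to ℕ-ring)
open import Data.Integer.Tactic.RingSolver using () renaming (ring to ℤ-ring)

ℚ-ring : AlmostCommutativeRing 0ℓ 0ℓ
ℚ-ring = fromCommutativeRing ℚP.+-*-commutativeRing (λ p → dec⇒maybe (0ℚ ℚP.≟ p))

-- Second-order linear recurrences

module LinearRecurrence {a ℓ} (R : CommutativeRing a ℓ) where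
  open CommutativeRing R hiding (refl) renaming (sym to ≈-sym; trans to ≈-trans)
  open import Algebra.Definitions.RawSemiring (Semiring.rawSemiring semiring) using (_^_)
  open import Algebra.Properties.Ring ring using (x[y-z]≈xy-xz; [y-z]x≈yx-zx; xyx⁻¹≈y; ⁻¹-anti-homo‿-)
  open import Algebra.Properties.CommutativeSemigroup *-commutativeSemigroup using (x∙yz≈zx∙y)
  open import Relation.Binary.Reasoning.Setoid setoid

  Satisfies : Carrier → Carrier → (ℕ → Carrier) → Set ℓ
  Satisfies a b x = ∀ i → x (suc (suc i)) ≈ a * x (suc i) - b * x i

  private
    -‿cong₂ : ∀ {p q r s} → p ≈ q → r ≈ s → p - r ≈ q - s
    -‿cong₂ p≈q r≈s = +-cong p≈q (-‿cong r≈s)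

    p+q-r-q≈p-r : ∀ p q r → p + q - r - q ≈ p - r
    p+q-r-q≈p-r p q r = begin
      p + q - r - q     ≈⟨ +-congʳ (+-congʳ (+-comm p q)) ⟩
      q + p - r - q     ≈⟨ +-congʳ (+-assoc q p (- r)) ⟩
      q + (p - r) - q   ≈⟨ xyx⁻¹≈y q (p - r) ⟩
      p - r             ∎

    y-a+[b-y]≈b-a : ∀ y a b → y - a + (b - y) ≈ b - a
    y-a+[b-y]≈b-a y a b = begin
      y - a + (b - y)     ≈⟨ +-comm (y - a) (b - y) ⟩
      b - y + (y - a)     ≈⟨ +-assoc b (- y) (y - a) ⟩
      b + (- y + (y - a)) ≈⟨ +-congˡ (≈-sym (+-assoc (- y) y (- a))) ⟩
      b + (- y + y - a)   ≈⟨ +-congˡ (+-congʳ (-‿inverseˡ y)) ⟩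
      b + (0# - a)        ≈⟨ +-congˡ (+-identityˡ (- a)) ⟩
      b - a               ∎

  swap-roots : ∀ {θ₁ θ₂ x} → Satisfies (θ₁ + θ₂) (θ₁ * θ₂) x →
               Satisfies (θ₂ + θ₁) (θ₂ * θ₁) x
  swap-roots {θ₁} {θ₂} x-rec i =
    ≈-trans (x-rec i) (-‿cong₂ (*-congʳ (+-comm θ₁ θ₂)) (*-congʳ (*-comm θ₁ θ₂)))

  difference-geometric : ∀ {θ₁ θ₂ x} → Satisfies (θ₁ + θ₂) (θ₁ * θ₂) x →
                       ∀ i → x (suc i) - θ₂ * x i ≈ θ₁ ^ i * (x 1 - θ₂ * x 0)
  difference-geometric {θ₁} {θ₂} {x} x-rec zero = ≈-sym (*-identityˡ _)
  difference-geometric {θ₁} {θ₂} {x} x-rec (suc i) = begin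
    x₂ - θ₂ * x₁                             ≈⟨ +-congʳ (x-rec i) ⟩
    (θ₁ + θ₂) * x₁ - θ₁ * θ₂ * x₀ - θ₂ * x₁  ≈⟨ +-congʳ (+-congʳ (distribʳ x₁ θ₁ θ₂)) ⟩
    θ₁ * x₁ + θ₂ * x₁ - θ₁ * θ₂ * x₀ - θ₂ * x₁ ≈⟨ p+q-r-q≈p-r (θ₁ * x₁) (θ₂ * x₁) (θ₁ * θ₂ * x₀) ⟩
    θ₁ * x₁ - θ₁ * θ₂ * x₀                   ≈⟨ +-congˡ (-‿cong (*-assoc θ₁ θ₂ x₀)) ⟩
    θ₁ * x₁ - θ₁ * (θ₂ * x₀)                 ≈⟨ x[y-z]≈xy-xz θ₁ x₁ (θ₂ * x₀) ⟨
    θ₁ * (x₁ - θ₂ * x₀)                      ≈⟨ *-congˡ (difference-geometric x-rec i) ⟩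
    θ₁ * (θ₁ ^ i * (x 1 - θ₂ * x 0))         ≈⟨ *-assoc θ₁ (θ₁ ^ i) _ ⟨
    θ₁ ^ suc i * (x 1 - θ₂ * x 0)            ∎
    where
    x₀ = x i; x₁ = x (suc i); x₂ = x (suc (suc i))

  binet : ∀ {θ₁ θ₂ w} (x : ℕ → Carrier) → w * (θ₁ - θ₂) ≈ 1# →
          Satisfies (θ₁ + θ₂) (θ₁ * θ₂) x →
          ∀ i → x i ≈ (x 1 - θ₂ * x 0) * w * θ₁ ^ i - (x 1 - θ₁ * x 0) * w * θ₂ ^ i
  binet {θ₁} {θ₂} {w} x w[θ₁-θ₂]≈1 x-rec i = begin
    x i                                        ≈⟨ *-identityˡ (x i) ⟨
    1# * x i                                   ≈⟨ *-congʳ w[θ₁-θ₂]≈1 ⟨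
    w * (θ₁ - θ₂) * x i                        ≈⟨ *-assoc w (θ₁ - θ₂) (x i) ⟩
    w * ((θ₁ - θ₂) * x i)                      ≈⟨ *-congˡ difference ⟨
    w * ((x′ - θ₂ * x i) - (x′ - θ₁ * x i))    ≈⟨ *-congˡ (-‿cong₂ (difference-geometric x-rec i)
                                                                  (difference-geometric (swap-roots x-rec) i)) ⟩
    w * (θ₁ ^ i * N₁ - θ₂ ^ i * N₂)             ≈⟨ x[y-z]≈xy-xz w (θ₁ ^ i * N₁) (θ₂ ^ i * N₂) ⟩
    w * (θ₁ ^ i * N₁) - w * (θ₂ ^ i * N₂)       ≈⟨ -‿cong₂ (x∙yz≈zx∙y w (θ₁ ^ i) N₁) (x∙yz≈zx∙y w (θ₂ ^ i) N₂) ⟩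
    N₁ * w * θ₁ ^ i - N₂ * w * θ₂ ^ i           ∎
    where
    x′ = x (suc i)
    N₁ = x 1 - θ₂ * x 0
    N₂ = x 1 - θ₁ * x 0
    difference : (x′ - θ₂ * x i) - (x′ - θ₁ * x i) ≈ (θ₁ - θ₂) * x i
    difference = begin
      (x′ - θ₂ * x i) - (x′ - θ₁ * x i)   ≈⟨ +-congˡ (⁻¹-anti-homo‿- x′ (θ₁ * x i)) ⟩
      (x′ - θ₂ * x i) + (θ₁ * x i - x′)   ≈⟨ y-a+[b-y]≈b-a x′ (θ₂ * x i) (θ₁ * x i) ⟩
      θ₁ * x i - θ₂ * x i                 ≈⟨ [y-z]x≈yx-zx (x i) θ₁ θ₂ ⟨
      (θ₁ - θ₂) * x i                     ∎

-- The quadratic field ℚ(√D)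

fromℤ : ℤ → ℚ
fromℤ i = i ℚ./ 1

fromℤ≡mkℚ : ∀ i → fromℤ i ≡ mkℚ i 0 (Coprime.sym (Coprime.1-coprimeTo ℤ.∣ i ∣))
fromℤ≡mkℚ i = ℚP.↥p/↧p≡p (mkℚ i 0 _)

fromℤ-homo-+ : ∀ i j → fromℤ (i ℤ.+ j) ≡ fromℤ i ℚ.+ fromℤ j
fromℤ-homo-+ i j rewrite fromℤ≡mkℚ i | fromℤ≡mkℚ j =
  cong fromℤ (cong₂ ℤ._+_ (sym (ℤP.*-identityʳ i)) (sym (ℤP.*-identityʳ j)))

fromℤ-homo-* : ∀ i j → fromℤ (i ℤ.* j) ≡ fromℤ i ℚ.* fromℤ j
fromℤ-homo-* i j rewrite fromℤ≡mkℚ i | fromℤ≡mkℚ j = refl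

fromℤ-homo‿- : ∀ i → fromℤ (ℤ.- i) ≡ ℚ.- fromℤ i
fromℤ-homo‿- (+ zero) = refl
fromℤ-homo‿- +[1+ n ] = refl
fromℤ-homo‿- -[1+ n ] =
  trans (fromℤ≡mkℚ +[1+ n ]) (cong (λ p → ℚ.- (ℚ.- p)) (sym (fromℤ≡mkℚ +[1+ n ])))

fromℤ-homo-- : ∀ i j → fromℤ (i ℤ.- j) ≡ fromℤ i ℚ.- fromℤ j
fromℤ-homo-- i j = trans (fromℤ-homo-+ i (ℤ.- j)) (cong (fromℤ i ℚ.+_) (fromℤ-homo‿- j))

fromℤ-mono-< : ∀ {i j} → i ℤ.< j → fromℤ i ℚ.< fromℤ j
fromℤ-mono-< {i} {j} i<j rewrite fromℤ≡mkℚ i | fromℤ≡mkℚ j =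
  ℚ.*<* (subst₂ ℤ._<_ (sym (ℤP.*-identityʳ i)) (sym (ℤP.*-identityʳ j)) i<j)

fromℤ-mono-≤ : ∀ {i j} → i ℤ.≤ j → fromℤ i ℚ.≤ fromℤ j
fromℤ-mono-≤ {i} {j} i≤j rewrite fromℤ≡mkℚ i | fromℤ≡mkℚ j =
  ℚ.*≤* (subst₂ ℤ._≤_ (sym (ℤP.*-identityʳ i)) (sym (ℤP.*-identityʳ j)) i≤j)

i/2≡fromℤi*½ : ∀ i → i ℚ./ 2 ≡ fromℤ i ℚ.* ½
i/2≡fromℤi*½ i rewrite fromℤ≡mkℚ i = cong (ℚ._/ 2) (sym (ℤP.*-identityʳ i))

module QDRing (D : ℚ) where

  infixl 6 _+ᴰ_ _-ᴰ_
  infixl 7 _*ᴰ_ _/ᴰ_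

  _+ᴰ_ _-ᴰ_ _*ᴰ_ _/ᴰ_ : QD → QD → QD
  _+ᴰ_ = _⊕_ D
  _-ᴰ_ = _⊖_ D
  _*ᴰ_ = _⊗_ D
  _/ᴰ_ = _⊘_ D

  negᴰ : QD → QD
  negᴰ (a , b) = (ℚ.- a , ℚ.- b)

  0ᴰ 1ᴰ √D : QD
  0ᴰ = (0ℚ , 0ℚ)
  1ᴰ = (1ℚ , 0ℚ)
  √D = sqrtD D

  -- The solver cannot look inside _⊗_, so the laws are first stated coordinatewise.
  private
    module Coordinates where
      open import Data.Rational using (_+_; _*_; _-_; -_)

      *-assoc₁ : ∀ D a b c d e f → (a * c + b * d * D) * e + (a * d + b * c) * f * D
                                 ≡ a * (c * e + d * f * D) + b * (c * f + d * e) * D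
      *-assoc₁ = solve-∀ ℚ-ring
      *-assoc₂ : ∀ D a b c d e f → (a * c + b * d * D) * f + (a * d + b * c) * e
                                 ≡ a * (c * f + d * e) + b * (c * e + d * f * D)
      *-assoc₂ = solve-∀ ℚ-ring
      *-comm₁ : ∀ D a b c d → a * c + b * d * D ≡ c * a + d * b * D
      *-comm₁ = solve-∀ ℚ-ring
      *-comm₂ : ∀ a b c d → a * d + b * c ≡ c * b + d * a
      *-comm₂ = solve-∀ ℚ-ring
      *-identityˡ₁ : ∀ D a b → 1ℚ * a + 0ℚ * b * D ≡ a
      *-identityˡ₁ = solve-∀ ℚ-ring
      *-identityˡ₂ : ∀ a b → 1ℚ * b + 0ℚ * a ≡ b
      *-identityˡ₂ = solve-∀ ℚ-ring
      *-distribʳ₁ : ∀ D a b c d e f → (c + e) * a + (d + f) * b * D ≡ (c * a + d * b * D) + (e * a + f * b * D)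
      *-distribʳ₁ = solve-∀ ℚ-ring
      *-distribʳ₂ : ∀ a b c d e f → (c + e) * b + (d + f) * a ≡ (c * b + d * a) + (e * b + f * a)
      *-distribʳ₂ = solve-∀ ℚ-ring
      emb-*₁ : ∀ D p q → p * q ≡ p * q + 0ℚ * 0ℚ * D
      emb-*₁ = solve-∀ ℚ-ring
      emb-*₂ : ∀ p q → 0ℚ ≡ p * 0ℚ + 0ℚ * q
      emb-*₂ = solve-∀ ℚ-ring
      inv₁ : ∀ D a b n → a * n * a + - (b * n) * b * D ≡ n * (a * a - b * b * D)
      inv₁ = solve-∀ ℚ-ring
      inv₂ : ∀ a b n → a * n * b + - (b * n) * a ≡ 0ℚ
      inv₂ = solve-∀ ℚ-ring
      *-√D₁ : ∀ D a b → a * 0ℚ + b * 1ℚ * D ≡ b * D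
      *-√D₁ = solve-∀ ℚ-ring
      *-√D₂ : ∀ a b → a * 1ℚ + b * 0ℚ ≡ a
      *-√D₂ = solve-∀ ℚ-ring
      norm-√D : ∀ D → 0ℚ * 0ℚ - 1ℚ * 1ℚ * D ≡ - D
      norm-√D = solve-∀ ℚ-ring
    open Coordinates

  *ᴰ-assoc : Associative _≡_ _*ᴰ_
  *ᴰ-assoc (a , b) (c , d) (e , f) = cong₂ _,_ (*-assoc₁ D a b c d e f) (*-assoc₂ D a b c d e f)

  *ᴰ-comm : Commutative _≡_ _*ᴰ_
  *ᴰ-comm (a , b) (c , d) = cong₂ _,_ (*-comm₁ D a b c d) (*-comm₂ a b c d)

  *ᴰ-identityˡ : LeftIdentity _≡_ 1ᴰ _*ᴰ_
  *ᴰ-identityˡ (a , b) = cong₂ _,_ (*-identityˡ₁ D a b) (*-identityˡ₂ a b)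

  *ᴰ-identityʳ : RightIdentity _≡_ 1ᴰ _*ᴰ_
  *ᴰ-identityʳ x = trans (*ᴰ-comm x 1ᴰ) (*ᴰ-identityˡ x)

  *ᴰ-distribʳ : _DistributesOverʳ_ _≡_ _*ᴰ_ _+ᴰ_
  *ᴰ-distribʳ (a , b) (c , d) (e , f) = cong₂ _,_ (*-distribʳ₁ D a b c d e f) (*-distribʳ₂ a b c d e f)

  *ᴰ-distribˡ : _DistributesOverˡ_ _≡_ _*ᴰ_ _+ᴰ_
  *ᴰ-distribˡ x y z =
    trans (*ᴰ-comm x (y +ᴰ z)) (trans (*ᴰ-distribʳ x y z) (cong₂ _+ᴰ_ (*ᴰ-comm y x) (*ᴰ-comm z x)))

  commutativeRing : CommutativeRing 0ℓ 0ℓ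
  commutativeRing = record
    { Carrier = QD
    ; _≈_ = _≡_
    ; _+_ = _+ᴰ_
    ; _*_ = _*ᴰ_
    ; -_ = negᴰ
    ; 0# = 0ᴰ
    ; 1# = 1ᴰ
    ; isCommutativeRing = record
      { isRing = record
        { +-isAbelianGroup = record
          { isGroup = record
            { isMonoid = record
              { isSemigroup = record
                { isMagma = record { isEquivalence = isEquivalence ; ∙-cong = cong₂ _+ᴰ_ }
                ; assoc = λ (a , b) (c , d) (e , f) → cong₂ _,_ (ℚP.+-assoc a c e) (ℚP.+-assoc b d f)
                }
              ; identity = (λ (a , b) → cong₂ _,_ (ℚP.+-identityˡ a) (ℚP.+-identityˡ b))
                         , (λ (a , b) → cong₂ _,_ (ℚP.+-identityʳ a) (ℚP.+-identityʳ b))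
              }
            ; inverse = (λ (a , b) → cong₂ _,_ (ℚP.+-inverseˡ a) (ℚP.+-inverseˡ b))
                      , (λ (a , b) → cong₂ _,_ (ℚP.+-inverseʳ a) (ℚP.+-inverseʳ b))
            ; ⁻¹-cong = cong negᴰ
            }
          ; comm = λ (a , b) (c , d) → cong₂ _,_ (ℚP.+-comm a c) (ℚP.+-comm b d)
          }
        ; *-cong = cong₂ _*ᴰ_
        ; *-assoc = *ᴰ-assoc
        ; *-identity = *ᴰ-identityˡ , *ᴰ-identityʳ
        ; distrib = *ᴰ-distribˡ , *ᴰ-distribʳ
        }
      ; *-comm = *ᴰ-comm
      }
    }

  open import Algebra.Definitions.RawSemiring (Semiring.rawSemiring (CommutativeRing.semiring commutativeRing))
    using (_^_)

  ^≡^^ : ∀ x i → x ^ i ≡ _^^_ D x i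
  ^≡^^ x zero    = refl
  ^≡^^ x (suc i) = cong (x *ᴰ_) (^≡^^ x i)

  emb-homo-* : ∀ p q → emb D (p ℚ.* q) ≡ emb D p *ᴰ emb D q
  emb-homo-* p q = cong₂ _,_ (emb-*₁ D p q) (emb-*₂ p q)

  embℤ-homo-* : ∀ i j → embℤ D (i ℤ.* j) ≡ embℤ D i *ᴰ embℤ D j
  embℤ-homo-* i j = trans (cong (emb D) (fromℤ-homo-* i j)) (emb-homo-* (fromℤ i) (fromℤ j))

  embℤ-homo-- : ∀ i j → embℤ D (i ℤ.- j) ≡ embℤ D i -ᴰ embℤ D j
  embℤ-homo-- i j = cong₂ _,_ (fromℤ-homo-- i j) refl

  norm : QD → ℚ
  norm (a , b) = a ℚ.* a ℚ.- b ℚ.* b ℚ.* D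

  invℚ-inverseˡ : ∀ p → p ≢ 0ℚ → invℚ D p ℚ.* p ≡ 1ℚ
  invℚ-inverseˡ p p≢0 with p ℚP.≟ 0ℚ
  ... | yes p≡0  = contradiction p≡0 p≢0
  ... | no  p≢0′ = ℚP.*-inverseˡ p {{ℚ.≢-nonZero p≢0′}}

  inv-inverseˡ : ∀ x → norm x ≢ 0ℚ → inv D x *ᴰ x ≡ 1ᴰ
  inv-inverseˡ (a , b) N≢0 =
    cong₂ _,_ (trans (inv₁ D a b n) (invℚ-inverseˡ (norm (a , b)) N≢0)) (inv₂ a b n)
    where n = invℚ D (norm (a , b))

  /ᴰ-*ᴰ-cancel : ∀ u v → inv D v *ᴰ v ≡ 1ᴰ → u /ᴰ v *ᴰ v ≡ u
  /ᴰ-*ᴰ-cancel u v v⁻¹v≡1 = trans (*ᴰ-assoc u (inv D v) v) (trans (cong (u *ᴰ_) v⁻¹v≡1) (*ᴰ-identityʳ u))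

  norm-√D≢0 : D ≢ 0ℚ → norm √D ≢ 0ℚ
  norm-√D≢0 D≢0 N≡0 = D≢0 (ℚP.neg-injective (trans (sym (norm-√D D)) N≡0))

  *ᴰ-√D : ∀ x → x *ᴰ √D ≡ (proj₂ x ℚ.* D , proj₁ x)
  *ᴰ-√D (a , b) = cong₂ _,_ (*-√D₁ D a b) (*-√D₂ a b)

positive-criterion : ∀ D {x y} → 0ℚ ℚ.< x → 0ℚ ℚ.≤ y ⊎ y ℚ.* y ℚ.* D ℚ.< x ℚ.* x →
                     Positive D (x , y)
positive-criterion D 0<x (inj₁ 0≤y) = inj₁ (ℚP.<⇒≤ 0<x , 0≤y , inj₁ 0<x)
positive-criterion D {y = y} 0<x (inj₂ yyD<xx) with y ℚP.<? 0ℚ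
... | yes y<0 = inj₂ (inj₁ (0<x , y<0 , yyD<xx))
... | no  y≮0 = inj₁ (ℚP.<⇒≤ 0<x , ℚP.≮⇒≥ y≮0 , inj₁ 0<x)

0≤i*i : ∀ i → + 0 ℤ.≤ i ℤ.* i
0≤i*i (+ n)    = subst (+ 0 ℤ.≤_) (sym (ℤP.+◃n≡+n (n ℕ.* n))) (ℤ.+≤+ ℕ.z≤n)
0≤i*i -[1+ n ] = ℤ.+≤+ ℕ.z≤n

0≤i∧0≤j⇒0≤i*j : ∀ {i j} → + 0 ℤ.≤ i → + 0 ℤ.≤ j → + 0 ℤ.≤ i ℤ.* j
0≤i∧0≤j⇒0≤i*j {i} {j} 0≤i 0≤j = ℤP.*-monoʳ-≤-nonNeg j {{ℤ.nonNegative 0≤j}} 0≤i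

1≤i∧1≤j⇒1≤i*j : ∀ {i j} → + 1 ℤ.≤ i → + 1 ℤ.≤ j → + 1 ℤ.≤ i ℤ.* j
1≤i∧1≤j⇒1≤i*j (ℤ.+≤+ (ℕ.s≤s ℕ.z≤n)) (ℤ.+≤+ (ℕ.s≤s ℕ.z≤n)) = ℤ.+≤+ (ℕ.s≤s ℕ.z≤n)

1≤i⇒0≤i : ∀ {i} → + 1 ℤ.≤ i → + 0 ℤ.≤ i
1≤i⇒0≤i = ℤP.≤-trans (ℤ.+≤+ ℕ.z≤n)

[-1]^k≤1 : ∀ k → (ℤ.- + 1) ℤ.^ k ℤ.≤ + 1
[-1]^k≤1 zero          = ℤP.≤-refl
[-1]^k≤1 (suc zero)    = ℤ.-≤+
[-1]^k≤1 (suc (suc k)) = subst (ℤ._≤ + 1) (sym (-1*-1*i≡i ((ℤ.- + 1) ℤ.^ k))) ([-1]^k≤1 k)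
  where
  -1*-1*i≡i : ∀ i → ℤ.- + 1 ℤ.* (ℤ.- + 1 ℤ.* i) ≡ i
  -1*-1*i≡i = solve-∀ ℤ-ring

-- With u = t q₀ − 2 q₁ ≥ 1 one has q₀² (t² − 4e) − (2q₁ − t q₀)² = 4 (q₁² − e q₀²) + 4 q₁ u,
-- and the certificate below splits this into manifestly nonnegative terms.
key-inequality : ∀ {q₀ q₁ t e} → + 1 ℤ.≤ q₀ → q₀ ℤ.≤ q₁ → e ℤ.≤ + 1 →
  + 2 ℤ.* q₁ ℤ.- t ℤ.* q₀ ℤ.< + 0 →
  (+ 2 ℤ.* q₁ ℤ.- t ℤ.* q₀) ℤ.* (+ 2 ℤ.* q₁ ℤ.- t ℤ.* q₀) ℤ.< q₀ ℤ.* q₀ ℤ.* (t ℤ.* t ℤ.- + 4 ℤ.* e)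
key-inequality {q₀} {q₁} {t} {e} 1≤q₀ q₀≤q₁ e≤1 m<0 =
  ℤP.suc[i]≤j⇒i<j (ℤP.0≤i-j⇒j≤i (subst (+ 0 ℤ.≤_) (certificate q₀ q₁ t e) nonnegative))
  where
  infixl 6 _⊞_
  infixl 7 _⊠_
  _⊞_ = ℤP.+-mono-≤
  _⊠_ = 0≤i∧0≤j⇒0≤i*j
  gap = ℤP.i≤j⇒0≤j-i
  0≤+ : ∀ n → + 0 ℤ.≤ + n
  0≤+ n = ℤ.+≤+ ℕ.z≤n
  0≤q₀ = 1≤i⇒0≤i 1≤q₀
  1≤q₁ = ℤP.≤-trans 1≤q₀ q₀≤q₁
  0≤q₁ = 1≤i⇒0≤i 1≤q₁
  nonnegative : + 0 ℤ.≤ + 4 ℤ.* ((q₁ ℤ.- q₀) ℤ.* (q₁ ℤ.+ q₀) ℤ.+ (+ 1 ℤ.- e) ℤ.* (q₀ ℤ.* q₀)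
                                ℤ.+ q₁ ℤ.* (+ 0 ℤ.- (+ 1 ℤ.+ (+ 2 ℤ.* q₁ ℤ.- t ℤ.* q₀))) ℤ.+ (q₁ ℤ.- + 1)) ℤ.+ + 3
  nonnegative = 0≤+ 4 ⊠ (gap q₀≤q₁ ⊠ (0≤q₁ ⊞ 0≤q₀) ⊞ gap e≤1 ⊠ (0≤q₀ ⊠ 0≤q₀)
                         ⊞ 0≤q₁ ⊠ gap (ℤP.i<j⇒suc[i]≤j m<0) ⊞ gap 1≤q₁)
                ⊞ 0≤+ 3
  certificate : ∀ q₀ q₁ t e →
    + 4 ℤ.* ((q₁ ℤ.- q₀) ℤ.* (q₁ ℤ.+ q₀) ℤ.+ (+ 1 ℤ.- e) ℤ.* (q₀ ℤ.* q₀)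
            ℤ.+ q₁ ℤ.* (+ 0 ℤ.- (+ 1 ℤ.+ (+ 2 ℤ.* q₁ ℤ.- t ℤ.* q₀))) ℤ.+ (q₁ ℤ.- + 1)) ℤ.+ + 3
    ≡ q₀ ℤ.* q₀ ℤ.* (t ℤ.* t ℤ.- + 4 ℤ.* e) ℤ.- (+ 1 ℤ.+ (+ 2 ℤ.* q₁ ℤ.- t ℤ.* q₀) ℤ.* (+ 2 ℤ.* q₁ ℤ.- t ℤ.* q₀))
  certificate = solve-∀ ℤ-ring

-- Products of continued-fraction matrices

record Matrix : Set where
  no-eta-equality
  pattern
  constructor mat
  field a₁₁ a₁₂ a₂₁ a₂₂ : ℤ
open Matrix

mat-cong : ∀ {a b c d a′ b′ c′ d′} → a ≡ a′ → b ≡ b′ → c ≡ c′ → d ≡ d′ →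
           mat a b c d ≡ mat a′ b′ c′ d′
mat-cong refl refl refl refl = refl

toMatrix : Mat2 → Matrix
toMatrix A = mat (A 0F 0F) (A 0F 1F) (A 1F 0F) (A 1F 1F)

infixl 7 _·_
_·_ : Matrix → Matrix → Matrix
mat a b c d · mat a′ b′ c′ d′ =
  mat (a ℤ.* a′ ℤ.+ b ℤ.* c′) (a ℤ.* b′ ℤ.+ b ℤ.* d′)
      (c ℤ.* a′ ℤ.+ d ℤ.* c′) (c ℤ.* b′ ℤ.+ d ℤ.* d′)

I₂ : Matrix
I₂ = mat (+ 1) (+ 0) (+ 0) (+ 1)

K : ℤ → Matrix
K x = mat x (+ 1) (+ 1) (+ 0)

tr : Matrix → ℤ
tr (mat a _ _ d) = a ℤ.+ d

det : Matrix → ℤ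
det (mat a b c d) = a ℤ.* d ℤ.- b ℤ.* c

prod : (ℕ → ℤ) → ℕ → Matrix
prod f k = toMatrix (prodM f k)

·-assoc : ∀ X Y Z → X · Y · Z ≡ X · (Y · Z)
·-assoc (mat a b c d) (mat e f g h) (mat i j k l) = mat-cong (row a b) (row′ a b) (row c d) (row′ c d)
  where
  row : ∀ x y → (x ℤ.* e ℤ.+ y ℤ.* g) ℤ.* i ℤ.+ (x ℤ.* f ℤ.+ y ℤ.* h) ℤ.* k
              ≡ x ℤ.* (e ℤ.* i ℤ.+ f ℤ.* k) ℤ.+ y ℤ.* (g ℤ.* i ℤ.+ h ℤ.* k)
  row x y = solve (x ∷ y ∷ e ∷ f ∷ g ∷ h ∷ i ∷ k ∷ []) ℤ-ring
  row′ : ∀ x y → (x ℤ.* e ℤ.+ y ℤ.* g) ℤ.* j ℤ.+ (x ℤ.* f ℤ.+ y ℤ.* h) ℤ.* l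
               ≡ x ℤ.* (e ℤ.* j ℤ.+ f ℤ.* l) ℤ.+ y ℤ.* (g ℤ.* j ℤ.+ h ℤ.* l)
  row′ x y = solve (x ∷ y ∷ e ∷ f ∷ g ∷ h ∷ j ∷ l ∷ []) ℤ-ring

·-identityˡ : ∀ X → I₂ · X ≡ X
·-identityˡ (mat a b c d) = mat-cong (solve (a ∷ c ∷ []) ℤ-ring) (solve (b ∷ d ∷ []) ℤ-ring)
                                    (solve (a ∷ c ∷ []) ℤ-ring) (solve (b ∷ d ∷ []) ℤ-ring)

·-identityʳ : ∀ X → X · I₂ ≡ X
·-identityʳ (mat a b c d) = mat-cong (solve (a ∷ b ∷ []) ℤ-ring) (solve (a ∷ b ∷ []) ℤ-ring)
                                    (solve (c ∷ d ∷ []) ℤ-ring) (solve (c ∷ d ∷ []) ℤ-ring)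

tr-·-comm : ∀ X Y → tr (X · Y) ≡ tr (Y · X)
tr-·-comm (mat a b c d) (mat e f g h) = expanded a b c d e f g h
  where
  expanded : ∀ a b c d e f g h → a ℤ.* e ℤ.+ b ℤ.* g ℤ.+ (c ℤ.* f ℤ.+ d ℤ.* h)
                               ≡ e ℤ.* a ℤ.+ f ℤ.* c ℤ.+ (g ℤ.* b ℤ.+ h ℤ.* d)
  expanded = solve-∀ ℤ-ring

det-· : ∀ X Y → det (X · Y) ≡ det X ℤ.* det Y
det-· (mat a b c d) (mat e f g h) = expanded a b c d e f g h
  where
  expanded : ∀ a b c d e f g h →
    (a ℤ.* e ℤ.+ b ℤ.* g) ℤ.* (c ℤ.* f ℤ.+ d ℤ.* h)
      ℤ.- (a ℤ.* f ℤ.+ b ℤ.* h) ℤ.* (c ℤ.* e ℤ.+ d ℤ.* g)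
    ≡ (a ℤ.* d ℤ.- b ℤ.* c) ℤ.* (e ℤ.* h ℤ.- f ℤ.* g)
  expanded = solve-∀ ℤ-ring

det-K : ∀ x → det (K x) ≡ ℤ.- + 1
det-K x = expanded x
  where
  expanded : ∀ x → x ℤ.* + 0 ℤ.- + 1 ℤ.* + 1 ≡ ℤ.- + 1
  expanded = solve-∀ ℤ-ring

cayley-hamilton₂₁ : ∀ A X → a₂₁ (A · X · X) ≡ tr X ℤ.* a₂₁ (A · X) ℤ.- det X ℤ.* a₂₁ A
cayley-hamilton₂₁ (mat a b c d) (mat e f g h) = expanded c d e f g h
  where
  expanded : ∀ c d e f g h →
    (c ℤ.* e ℤ.+ d ℤ.* g) ℤ.* e ℤ.+ (c ℤ.* f ℤ.+ d ℤ.* h) ℤ.* g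
    ≡ (e ℤ.+ h) ℤ.* (c ℤ.* e ℤ.+ d ℤ.* g) ℤ.- (e ℤ.* h ℤ.- f ℤ.* g) ℤ.* c
  expanded = solve-∀ ℤ-ring

discriminant : ∀ X → tr X ℤ.* tr X ℤ.- + 4 ℤ.* det X
                   ≡ (a₁₁ X ℤ.- a₂₂ X) ℤ.* (a₁₁ X ℤ.- a₂₂ X) ℤ.+ + 4 ℤ.* (a₁₂ X ℤ.* a₂₁ X)
discriminant (mat a b c d) = expanded a b c d
  where
  expanded : ∀ a b c d → (a ℤ.+ d) ℤ.* (a ℤ.+ d) ℤ.- + 4 ℤ.* (a ℤ.* d ℤ.- b ℤ.* c)
                       ≡ (a ℤ.- d) ℤ.* (a ℤ.- d) ℤ.+ + 4 ℤ.* (b ℤ.* c)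
  expanded = solve-∀ ℤ-ring

prod-cong : ∀ {f g} → (∀ j → f j ≡ g j) → ∀ k → prod f k ≡ prod g k
prod-cong f≗g zero    = refl
prod-cong f≗g (suc k) = cong₂ (λ P x → P · K x) (prod-cong f≗g k) (f≗g k)

prod-+ : ∀ f m k → prod f (m ℕ.+ k) ≡ prod f m · prod (λ j → f (m ℕ.+ j)) k
prod-+ f m zero    rewrite ℕP.+-identityʳ m = sym (·-identityʳ (prod f m))
prod-+ f m (suc k) rewrite ℕP.+-suc m k = begin
  prod f (m ℕ.+ k) · K (f (m ℕ.+ k))                                ≡⟨ cong (_· K (f (m ℕ.+ k))) (prod-+ f m k) ⟩
  prod f m · prod (λ j → f (m ℕ.+ j)) k · K (f (m ℕ.+ k))          ≡⟨ ·-assoc (prod f m) _ _ ⟩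
  prod f m · (prod (λ j → f (m ℕ.+ j)) k · K (f (m ℕ.+ k)))        ∎
  where open ≡-Reasoning

tr-rotate : ∀ f k → f k ≡ f 0 → tr (prod (λ j → f (suc j)) k) ≡ tr (prod f k)
tr-rotate f zero    _         = refl
tr-rotate f (suc k) fₖ₊₁≡f₀ = begin
  tr (prod (λ j → f (suc j)) k · K (f (suc k)))  ≡⟨ cong (λ x → tr (prod (λ j → f (suc j)) k · K x)) fₖ₊₁≡f₀ ⟩
  tr (prod (λ j → f (suc j)) k · K (f 0))        ≡⟨ tr-·-comm (prod (λ j → f (suc j)) k) (K (f 0)) ⟩
  tr (K (f 0) · prod (λ j → f (suc j)) k)        ≡⟨ cong (λ P → tr (P · prod (λ j → f (suc j)) k)) (·-identityˡ (K (f 0))) ⟨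
  tr (prod f 1 · prod (λ j → f (suc j)) k)       ≡⟨ cong tr (prod-+ f 1 k) ⟨
  tr (prod f (suc k))                            ∎
  where open ≡-Reasoning

det-prod : ∀ f k → det (prod f k) ≡ (ℤ.- + 1) ℤ.^ k
det-prod f zero    = refl
det-prod f (suc k) = begin
  det (prod f k · K (f k))              ≡⟨ det-· (prod f k) (K (f k)) ⟩
  det (prod f k) ℤ.* det (K (f k))      ≡⟨ cong₂ ℤ._*_ (det-prod f k) (det-K (f k)) ⟩
  (ℤ.- + 1) ℤ.^ k ℤ.* ℤ.- + 1           ≡⟨ ℤP.*-comm ((ℤ.- + 1) ℤ.^ k) (ℤ.- + 1) ⟩
  (ℤ.- + 1) ℤ.^ suc k                   ∎
  where open ≡-Reasoning

·-K : ∀ P x → P · K x ≡ mat (a₁₁ P ℤ.* x ℤ.+ a₁₂ P) (a₁₁ P) (a₂₁ P ℤ.* x ℤ.+ a₂₂ P) (a₂₁ P)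
·-K (mat a b c d) x = mat-cong (solve (a ∷ b ∷ x ∷ []) ℤ-ring) (solve (a ∷ b ∷ []) ℤ-ring)
                              (solve (c ∷ d ∷ x ∷ []) ℤ-ring) (solve (c ∷ d ∷ []) ℤ-ring)

qPair≡row₂ : ∀ c n → qPair c n ≡ (a₂₂ (prod c (suc n)) , a₂₁ (prod c (suc n)))
qPair≡row₂ c zero    = refl
qPair≡row₂ c (suc n) = begin
  qPair c (suc n)                             ≡⟨ cong (λ q → (proj₂ q , x ℤ.* proj₂ q ℤ.+ proj₁ q)) (qPair≡row₂ c n) ⟩
  (a₂₁ P , x ℤ.* a₂₁ P ℤ.+ a₂₂ P)             ≡⟨ cong (λ y → (a₂₁ P , y ℤ.+ a₂₂ P)) (ℤP.*-comm x (a₂₁ P)) ⟩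
  (a₂₁ P , a₂₁ P ℤ.* x ℤ.+ a₂₂ P)             ≡⟨ cong (λ M → (a₂₂ M , a₂₁ M)) (·-K P x) ⟨
  (a₂₂ (P · K x) , a₂₁ (P · K x))             ∎
  where
  open ≡-Reasoning
  P = prod c (suc n)
  x = c (suc n)

convDen≡a₂₁ : ∀ c n → convDen c n ≡ a₂₁ (prod c (suc n))
convDen≡a₂₁ c n = cong proj₂ (qPair≡row₂ c n)

EntryBounds : Matrix → Set
EntryBounds M = + 1 ℤ.≤ a₁₁ M × + 1 ℤ.≤ a₁₂ M × + 1 ℤ.≤ a₂₁ M × + 0 ℤ.≤ a₂₂ M

prod-entryBounds : ∀ {f} → (∀ j → + 1 ℤ.≤ f j) → ∀ k → EntryBounds (prod f (suc k))
prod-entryBounds {f} f≥1 zero =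
  subst EntryBounds (sym (·-identityˡ (K (f 0)))) (f≥1 0 , ℤP.≤-refl , ℤP.≤-refl , ℤ.+≤+ ℕ.z≤n)
prod-entryBounds {f} f≥1 (suc k) with prod-entryBounds f≥1 k
... | 1≤a , 1≤b , 1≤c , 0≤d = subst EntryBounds (sym (·-K P x))
  ( ℤP.≤-trans (1≤i∧1≤j⇒1≤i*j 1≤a (f≥1 (suc k))) (ℤP.i≤i+j _ _ {{ℤ.nonNegative (1≤i⇒0≤i 1≤b)}})
  , 1≤a
  , ℤP.≤-trans (1≤i∧1≤j⇒1≤i*j 1≤c (f≥1 (suc k))) (ℤP.i≤i+j _ _ {{ℤ.nonNegative 0≤d}})
  , 1≤i⇒0≤i 1≤c )
  where
  P = prod f (suc k)
  x = f (suc k)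

prod-discriminant-positive : ∀ {f} → (∀ j → + 1 ℤ.≤ f j) → ∀ {k} → 1 ≤ k →
  + 0 ℤ.< tr (prod f k) ℤ.* tr (prod f k) ℤ.- + 4 ℤ.* det (prod f k)
prod-discriminant-positive {f} f≥1 {suc k} _ with prod-entryBounds f≥1 k
... | _ , 1≤b , 1≤c , _ = subst (+ 0 ℤ.<_) (sym (discriminant P))
  (ℤP.+-mono-≤-< (0≤i*i (a₁₁ P ℤ.- a₂₂ P))
                 (ℤP.suc[i]≤j⇒i<j {+ 0}
                    (1≤i∧1≤j⇒1≤i*j {+ 4} (ℤ.+≤+ (ℕ.s≤s ℕ.z≤n)) (1≤i∧1≤j⇒1≤i*j 1≤b 1≤c))))
  where P = prod f (suc k)

-- Convergent denominators of an eventually periodic expansion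

module _ {c : ℕ → ℤ} (c≥1 : ∀ i → 1 ≤ i → + 1 ℤ.≤ c i) where

  qPair-bounds : ∀ n → + 0 ℤ.≤ proj₁ (qPair c n) × proj₁ (qPair c n) ℤ.≤ convDen c n × + 1 ℤ.≤ convDen c n
  qPair-bounds zero = ℤ.+≤+ ℕ.z≤n , ℤ.+≤+ ℕ.z≤n , ℤP.≤-refl
  qPair-bounds (suc n) with qPair-bounds n
  ... | 0≤q′ , _ , 1≤q = 1≤i⇒0≤i 1≤q , q≤xq+q′ , ℤP.≤-trans 1≤q q≤xq+q′
    where
    q = convDen c n
    x = c (suc n)
    q≤xq+q′ : q ℤ.≤ x ℤ.* q ℤ.+ proj₁ (qPair c n)
    q≤xq+q′ = ℤP.≤-trans
      (subst (ℤ._≤ x ℤ.* q) (ℤP.*-identityˡ q)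
             (ℤP.*-monoʳ-≤-nonNeg q {{ℤ.nonNegative (1≤i⇒0≤i 1≤q)}} (c≥1 (suc n) (ℕ.s≤s ℕ.z≤n))))
      (ℤP.i≤i+j _ _ {{ℤ.nonNegative 0≤q′}})

  convDen-positive : ∀ n → + 1 ℤ.≤ convDen c n
  convDen-positive n = proj₂ (proj₂ (qPair-bounds n))

  convDen-mono : ∀ {m n} → m ≤ n → convDen c m ℤ.≤ convDen c n
  convDen-mono m≤n = mono′ (ℕP.≤⇒≤′ m≤n)
    where
    mono′ : ∀ {m n} → m ℕ.≤′ n → convDen c m ℤ.≤ convDen c n
    mono′ ℕ.≤′-refl          = ℤP.≤-refl
    mono′ {n = suc n} (ℕ.≤′-step m≤′n) =
      ℤP.≤-trans (mono′ m≤′n) (proj₁ (proj₂ (qPair-bounds (suc n))))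

module EventuallyPeriodic (c : ℕ → ℤ) (r s : ℕ) (periodic : ∀ i → r ≤ i → c (i ℕ.+ s) ≡ c i) where

  window : ℕ → Matrix
  window m = prod (λ j → c (m ℕ.+ j)) s

  window-periodic : ∀ {m} → r ≤ m → window (m ℕ.+ s) ≡ window m
  window-periodic {m} r≤m = prod-cong shift s
    where
    swap : ∀ m s j → m ℕ.+ s ℕ.+ j ≡ m ℕ.+ j ℕ.+ s
    swap = solve-∀ ℕ-ring
    shift : ∀ j → c (m ℕ.+ s ℕ.+ j) ≡ c (m ℕ.+ j)
    shift j = trans (cong c (swap m s j)) (periodic (m ℕ.+ j) (ℕP.≤-trans r≤m (ℕP.m≤m+n m j)))

  tr-window-suc : ∀ {m} → r ≤ m → tr (window (suc m)) ≡ tr (window m)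
  tr-window-suc {m} r≤m = trans (cong tr (prod-cong (λ j → cong c (sym (ℕP.+-suc m j))) s))
    (tr-rotate (λ j → c (m ℕ.+ j)) s (trans (periodic m r≤m) (cong c (sym (ℕP.+-identityʳ m)))))

  tr-window : ∀ {m} → r ≤ m → tr (window m) ≡ tα c r s
  tr-window r≤m = from-≤′ (ℕP.≤⇒≤′ r≤m)
    where
    from-≤′ : ∀ {m} → r ℕ.≤′ m → tr (window m) ≡ tα c r s
    from-≤′ ℕ.≤′-refl            = refl
    from-≤′ (ℕ.≤′-step r≤′m) = trans (tr-window-suc (ℕP.≤′⇒≤ r≤′m)) (from-≤′ r≤′m)

  -- q at n + 2s, n + s, n are the (2,1) entries of A X², A X, A for the period matrix X = window (n + 1).
  convDen-recurrence : ∀ {n} → r ≤ n →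
    convDen c (n ℕ.+ s ℕ.+ s) ≡ tα c r s ℤ.* convDen c (n ℕ.+ s) ℤ.- (ℤ.- + 1) ℤ.^ s ℤ.* convDen c n
  convDen-recurrence {n} r≤n = begin
    convDen c (n ℕ.+ s ℕ.+ s)                 ≡⟨ convDen≡a₂₁ c (n ℕ.+ s ℕ.+ s) ⟩
    a₂₁ (prod c (suc n ℕ.+ s ℕ.+ s))          ≡⟨ cong a₂₁ (prod-+ c (suc n ℕ.+ s) s) ⟩
    a₂₁ (prod c (suc n ℕ.+ s) · window (suc n ℕ.+ s))
      ≡⟨ cong₂ (λ P Y → a₂₁ (P · Y)) (prod-+ c (suc n) s) (window-periodic (ℕP.m≤n⇒m≤1+n r≤n)) ⟩
    a₂₁ (A · X · X)                           ≡⟨ cayley-hamilton₂₁ A X ⟩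
    tr X ℤ.* a₂₁ (A · X) ℤ.- det X ℤ.* a₂₁ A
      ≡⟨ cong₂ (λ t e → t ℤ.* a₂₁ (A · X) ℤ.- e ℤ.* a₂₁ A) (tr-window (ℕP.m≤n⇒m≤1+n r≤n)) (det-prod _ s) ⟩
    tα c r s ℤ.* a₂₁ (A · X) ℤ.- (ℤ.- + 1) ℤ.^ s ℤ.* a₂₁ A
      ≡⟨ cong₂ (λ u v → tα c r s ℤ.* u ℤ.- (ℤ.- + 1) ℤ.^ s ℤ.* v)
               (trans (cong a₂₁ (sym (prod-+ c (suc n) s))) (sym (convDen≡a₂₁ c (n ℕ.+ s))))
               (sym (convDen≡a₂₁ c n)) ⟩
    tα c r s ℤ.* convDen c (n ℕ.+ s) ℤ.- (ℤ.- + 1) ℤ.^ s ℤ.* convDen c n ∎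
    where
    open ≡-Reasoning
    A = prod c (suc n)
    X = window (suc n)

  qj-recurrence : ∀ j i → qj c r s j (suc (suc i))
                        ≡ tα c r s ℤ.* qj c r s j (suc i) ℤ.- (ℤ.- + 1) ℤ.^ s ℤ.* qj c r s j i
  qj-recurrence j i = begin
    convDen c (s ℕ.* suc (suc i) ℕ.+ j ℕ.+ r)       ≡⟨ cong (convDen c) (index₂ s i j r) ⟩
    convDen c (n ℕ.+ s ℕ.+ s)                         ≡⟨ convDen-recurrence (ℕP.m≤n+m r (s ℕ.* i ℕ.+ j)) ⟩
    tα c r s ℤ.* convDen c (n ℕ.+ s) ℤ.- (ℤ.- + 1) ℤ.^ s ℤ.* convDen c n
      ≡⟨ cong (λ m → tα c r s ℤ.* convDen c m ℤ.- (ℤ.- + 1) ℤ.^ s ℤ.* convDen c n) (sym (index₁ s i j r)) ⟩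
    tα c r s ℤ.* qj c r s j (suc i) ℤ.- (ℤ.- + 1) ℤ.^ s ℤ.* qj c r s j i ∎
    where
    open ≡-Reasoning
    n = s ℕ.* i ℕ.+ j ℕ.+ r
    index₂ : ∀ s i j r → s ℕ.* suc (suc i) ℕ.+ j ℕ.+ r ≡ s ℕ.* i ℕ.+ j ℕ.+ r ℕ.+ s ℕ.+ s
    index₂ = solve-∀ ℕ-ring
    index₁ : ∀ s i j r → s ℕ.* suc i ℕ.+ j ℕ.+ r ≡ s ℕ.* i ℕ.+ j ℕ.+ r ℕ.+ s
    index₁ = solve-∀ ℕ-ring

  module _ (1≤s : 1 ≤ s) (c≥1 : ∀ i → 1 ≤ i → + 1 ℤ.≤ c i) where

    period-positive : ∀ i → r ≤ i → + 1 ℤ.≤ c i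
    period-positive zero    r≤0 = subst (+ 1 ℤ.≤_) (periodic 0 r≤0) (c≥1 s 1≤s)
    period-positive (suc i) _   = c≥1 (suc i) (ℕ.s≤s ℕ.z≤n)

    discriminant-positive : + 0 ℤ.< tα c r s ℤ.* tα c r s ℤ.- + 4 ℤ.* (ℤ.- + 1) ℤ.^ s
    discriminant-positive = subst (λ d → + 0 ℤ.< tα c r s ℤ.* tα c r s ℤ.- + 4 ℤ.* d) (det-prod _ s)
      (prod-discriminant-positive (λ j → period-positive (r ℕ.+ j) (ℕP.m≤m+n r j)) 1≤s)

  qj-mono : (∀ i → 1 ≤ i → + 1 ℤ.≤ c i) → ∀ j → qj c r s j 0 ℤ.≤ qj c r s j 1
  qj-mono c≥1 j = convDen-mono c≥1 (ℕP.+-monoˡ-≤ r (ℕP.+-monoˡ-≤ j (ℕP.*-monoʳ-≤ s ℕ.z≤n)))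

-- The characteristic roots θ₁, θ₂ in ℚ(√D)

module CharacteristicRoots (t e : ℤ) where

  Δ : ℤ
  Δ = t ℤ.* t ℤ.- + 4 ℤ.* e

  D : ℚ
  D = fromℤ Δ

  -½ : ℚ
  -½ = ℤ.- (+ 1) ℚ./ 2

  θ₊ θ₋ : QD
  θ₊ = (t ℚ./ 2 , + 1 ℚ./ 2)
  θ₋ = (t ℚ./ 2 , -½)

  open QDRing D
  open LinearRecurrence commutativeRing using (Satisfies; binet)

  θ₊+θ₋≡t : θ₊ +ᴰ θ₋ ≡ embℤ D t
  θ₊+θ₋≡t = cong₂ _,_ (trans (cong₂ ℚ._+_ (i/2≡fromℤi*½ t) (i/2≡fromℤi*½ t)) (halves (fromℤ t))) refl
    where
    halves : ∀ T → T ℚ.* ½ ℚ.+ T ℚ.* ½ ≡ T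
    halves = solve-∀ ℚ-ring

  θ₊θ₋≡e : θ₊ *ᴰ θ₋ ≡ embℤ D e
  θ₊θ₋≡e = cong₂ _,_
    (trans (cong₂ (λ h d → h ℚ.* h ℚ.+ ½ ℚ.* -½ ℚ.* d) (i/2≡fromℤi*½ t) D≡T²-4E)
           (vieta₁ (fromℤ t) (fromℤ e)))
    (trans (cong (λ h → h ℚ.* -½ ℚ.+ ½ ℚ.* h) (i/2≡fromℤi*½ t)) (vieta₂ (fromℤ t)))
    where
    D≡T²-4E : D ≡ fromℤ t ℚ.* fromℤ t ℚ.- fromℤ (+ 4) ℚ.* fromℤ e
    D≡T²-4E = trans (fromℤ-homo-- (t ℤ.* t) (+ 4 ℤ.* e))
                    (cong₂ ℚ._-_ (fromℤ-homo-* t t) (fromℤ-homo-* (+ 4) e))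
    vieta₁ : ∀ T E → T ℚ.* ½ ℚ.* (T ℚ.* ½) ℚ.+ ½ ℚ.* -½ ℚ.* (T ℚ.* T ℚ.- fromℤ (+ 4) ℚ.* E) ≡ E
    vieta₁ = solve-∀ ℚ-ring
    vieta₂ : ∀ T → T ℚ.* ½ ℚ.* -½ ℚ.+ ½ ℚ.* (T ℚ.* ½) ≡ 0ℚ
    vieta₂ = solve-∀ ℚ-ring

  θ₊-θ₋≡√D : θ₊ -ᴰ θ₋ ≡ √D
  θ₊-θ₋≡√D = cong₂ _,_ (ℚP.+-inverseʳ (t ℚ./ 2)) refl

  coefficient : QD → ℤ → ℤ → QD
  coefficient θ q₀ q₁ = (embℤ D q₁ -ᴰ θ *ᴰ embℤ D q₀) /ᴰ (θ₊ -ᴰ θ₋)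

  module _ (0<Δ : + 0 ℤ.< Δ) where

    0<D : 0ℚ ℚ.< D
    0<D = fromℤ-mono-< 0<Δ

    [θ₊-θ₋]⁻¹ : inv D (θ₊ -ᴰ θ₋) *ᴰ (θ₊ -ᴰ θ₋) ≡ 1ᴰ
    [θ₊-θ₋]⁻¹ = subst (λ δ → inv D δ *ᴰ δ ≡ 1ᴰ) (sym θ₊-θ₋≡√D)
      (inv-inverseˡ √D (norm-√D≢0 (λ D≡0 → ℚP.<-irrefl (sym D≡0) 0<D)))

    closed-form : (x : ℕ → ℤ) → (∀ i → x (suc (suc i)) ≡ t ℤ.* x (suc i) ℤ.- e ℤ.* x i) →
      ∀ i → embℤ D (x i) ≡ coefficient θ₋ (x 0) (x 1) *ᴰ _^^_ D θ₊ i
                          -ᴰ coefficient θ₊ (x 0) (x 1) *ᴰ _^^_ D θ₋ i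
    closed-form x x-rec i =
      trans (binet {θ₊} {θ₋} {inv D (θ₊ -ᴰ θ₋)} X [θ₊-θ₋]⁻¹ X-rec i)
            (cong₂ (λ p q → coefficient θ₋ (x 0) (x 1) *ᴰ p -ᴰ coefficient θ₊ (x 0) (x 1) *ᴰ q)
                   (^≡^^ θ₊ i) (^≡^^ θ₋ i))
      where
      X : ℕ → QD
      X i = embℤ D (x i)
      X-rec : Satisfies (θ₊ +ᴰ θ₋) (θ₊ *ᴰ θ₋) X
      X-rec i = begin
        embℤ D (x (suc (suc i)))                         ≡⟨ cong (embℤ D) (x-rec i) ⟩
        embℤ D (t ℤ.* x (suc i) ℤ.- e ℤ.* x i)           ≡⟨ embℤ-homo-- (t ℤ.* x (suc i)) (e ℤ.* x i) ⟩
        embℤ D (t ℤ.* x (suc i)) -ᴰ embℤ D (e ℤ.* x i)   ≡⟨ cong₂ _-ᴰ_ (embℤ-homo-* t (x (suc i)))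
                                                                     (embℤ-homo-* e (x i)) ⟩
        embℤ D t *ᴰ X (suc i) -ᴰ embℤ D e *ᴰ X i         ≡⟨ cong₂ (λ a b → a *ᴰ X (suc i) -ᴰ b *ᴰ X i)
                                                                  (sym θ₊+θ₋≡t) (sym θ₊θ₋≡e) ⟩
        (θ₊ +ᴰ θ₋) *ᴰ X (suc i) -ᴰ (θ₊ *ᴰ θ₋) *ᴰ X i     ∎
        where open ≡-Reasoning

    coefficient-positive : e ℤ.≤ + 1 → ∀ {q₀ q₁} → + 1 ℤ.≤ q₀ → q₀ ℤ.≤ q₁ →
                           Positive D (coefficient θ₋ q₀ q₁)
    coefficient-positive e≤1 {q₀} {q₁} 1≤q₀ q₀≤q₁ = positive-criterion D 0<x y-condition
      where
      open ℚP.≤-Reasoning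
      C = coefficient θ₋ q₀ q₁
      x = proj₁ C
      y = proj₂ C
      Q₀ = fromℤ q₀
      m = + 2 ℤ.* q₁ ℤ.- t ℤ.* q₀
      N = embℤ D q₁ -ᴰ θ₋ *ᴰ embℤ D q₀

      -- C √D = q₁ − θ₋ q₀ determines both coordinates of C.
      [yD,x]≡N : (y ℚ.* D , x) ≡ N
      [yD,x]≡N = trans (sym (*ᴰ-√D C))
        (subst (λ δ → C *ᴰ δ ≡ N) θ₊-θ₋≡√D (/ᴰ-*ᴰ-cancel N (θ₊ -ᴰ θ₋) [θ₊-θ₋]⁻¹))

      x≡Q₀½ : x ≡ Q₀ ℚ.* ½
      x≡Q₀½ = trans (cong proj₂ [yD,x]≡N) (second (t ℚ./ 2) Q₀)
        where
        second : ∀ h Q → 0ℚ ℚ.- (h ℚ.* 0ℚ ℚ.+ -½ ℚ.* Q) ≡ Q ℚ.* ½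
        second = solve-∀ ℚ-ring

      yD≡m½ : y ℚ.* D ≡ fromℤ m ℚ.* ½
      yD≡m½ = begin-equality
        y ℚ.* D                                                   ≡⟨ cong proj₁ [yD,x]≡N ⟩
        fromℤ q₁ ℚ.- (t ℚ./ 2 ℚ.* Q₀ ℚ.+ -½ ℚ.* 0ℚ ℚ.* D)          ≡⟨ cong (λ h → fromℤ q₁ ℚ.- (h ℚ.* Q₀ ℚ.+ -½ ℚ.* 0ℚ ℚ.* D))
                                                                         (i/2≡fromℤi*½ t) ⟩
        fromℤ q₁ ℚ.- (fromℤ t ℚ.* ½ ℚ.* Q₀ ℚ.+ -½ ℚ.* 0ℚ ℚ.* D)  ≡⟨ first (fromℤ q₁) (fromℤ t) Q₀ D ⟩
        (fromℤ (+ 2) ℚ.* fromℤ q₁ ℚ.- fromℤ t ℚ.* Q₀) ℚ.* ½       ≡⟨ cong (ℚ._* ½) m-expand ⟨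
        fromℤ m ℚ.* ½                                             ∎
        where
        first : ∀ P T Q D → P ℚ.- (T ℚ.* ½ ℚ.* Q ℚ.+ -½ ℚ.* 0ℚ ℚ.* D)
                          ≡ (fromℤ (+ 2) ℚ.* P ℚ.- T ℚ.* Q) ℚ.* ½
        first = solve-∀ ℚ-ring
        m-expand : fromℤ m ≡ fromℤ (+ 2) ℚ.* fromℤ q₁ ℚ.- fromℤ t ℚ.* Q₀
        m-expand = trans (fromℤ-homo-- (+ 2 ℤ.* q₁) (t ℤ.* q₀))
                         (cong₂ ℚ._-_ (fromℤ-homo-* (+ 2) q₁) (fromℤ-homo-* t q₀))

      0<x : 0ℚ ℚ.< x
      0<x = subst (0ℚ ℚ.<_) (sym x≡Q₀½)
                  (ℚP.*-monoˡ-<-pos ½ (fromℤ-mono-< (ℤP.suc[i]≤j⇒i<j {+ 0} 1≤q₀)))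

      y-condition : 0ℚ ℚ.≤ y ⊎ y ℚ.* y ℚ.* D ℚ.< x ℚ.* x
      y-condition with m ℤP.<? + 0
      ... | no  m≮0 = inj₁ (ℚP.*-cancelʳ-≤-pos D {{ℚ.positive 0<D}} (begin
        0ℚ ℚ.* D      ≡⟨ ℚP.*-zeroˡ D ⟩
        0ℚ ℚ.* ½      ≤⟨ ℚP.*-monoʳ-≤-nonNeg ½ (fromℤ-mono-≤ (ℤP.≮⇒≥ m≮0)) ⟩
        fromℤ m ℚ.* ½ ≡⟨ yD≡m½ ⟨
        y ℚ.* D       ∎))
      ... | yes m<0 = inj₂ (ℚP.*-cancelʳ-<-nonNeg D {{ℚ.nonNegative (ℚP.<⇒≤ 0<D)}} (begin-strict
        y ℚ.* y ℚ.* D ℚ.* D                ≡⟨ regroup y D ⟩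
        y ℚ.* D ℚ.* (y ℚ.* D)              ≡⟨ cong₂ ℚ._*_ yD≡m½ yD≡m½ ⟩
        fromℤ m ℚ.* ½ ℚ.* (fromℤ m ℚ.* ½)   ≡⟨ quarter (fromℤ m) ⟩
        fromℤ m ℚ.* fromℤ m ℚ.* ¼           ≡⟨ cong (ℚ._* ¼) (fromℤ-homo-* m m) ⟨
        fromℤ (m ℤ.* m) ℚ.* ¼               <⟨ ℚP.*-monoˡ-<-pos ¼ (fromℤ-mono-<
                                                   (key-inequality {q₀} {q₁} {t} {e} 1≤q₀ q₀≤q₁ e≤1 m<0)) ⟩
        fromℤ (q₀ ℤ.* q₀ ℤ.* Δ) ℚ.* ¼       ≡⟨ cong (ℚ._* ¼) (trans (fromℤ-homo-* (q₀ ℤ.* q₀) Δ)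
                                                                   (cong (ℚ._* D) (fromℤ-homo-* q₀ q₀))) ⟩
        Q₀ ℚ.* Q₀ ℚ.* D ℚ.* ¼               ≡⟨ quarter-scaled Q₀ D ⟨
        Q₀ ℚ.* ½ ℚ.* (Q₀ ℚ.* ½) ℚ.* D       ≡⟨ cong (λ z → z ℚ.* z ℚ.* D) x≡Q₀½ ⟨
        x ℚ.* x ℚ.* D                       ∎))
        where
        ¼ = ½ ℚ.* ½
        regroup : ∀ y D → y ℚ.* y ℚ.* D ℚ.* D ≡ y ℚ.* D ℚ.* (y ℚ.* D)
        regroup = solve-∀ ℚ-ring
        quarter : ∀ a → a ℚ.* ½ ℚ.* (a ℚ.* ½) ≡ a ℚ.* a ℚ.* (½ ℚ.* ½)
        quarter = solve-∀ ℚ-ring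
        quarter-scaled : ∀ a b → a ℚ.* ½ ℚ.* (a ℚ.* ½) ℚ.* b ≡ a ℚ.* a ℚ.* b ℚ.* (½ ℚ.* ½)
        quarter-scaled = solve-∀ ℚ-ring

lemma2p1 : (c : ℕ → ℤ) (r s : ℕ) → 1 ≤ s
    → (∀ i → 1 ≤ i → + 1 ℤ.≤ c i)
    → (∀ i → r ≤ i → c (i ℕ.+ s) ≡ c i)
    → ∀ j → j < s
    → (∀ i → embℤ (Dα c r s) (qj c r s j i)
             ≡ _⊖_ (Dα c r s) (_⊗_ (Dα c r s) (c₁ c r s j) (_^^_ (Dα c r s) (θ₁ c r s) i))
                              (_⊗_ (Dα c r s) (c₂ c r s j) (_^^_ (Dα c r s) (θ₂ c r s) i)))
      × Positive (Dα c r s) (c₁ c r s j)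
lemma2p1 c r s 1≤s c≥1 periodic j _ =
    closed-form 0<Δ (qj c r s j) (qj-recurrence j)
  , coefficient-positive 0<Δ ([-1]^k≤1 s) (convDen-positive c≥1 (s ℕ.* 0 ℕ.+ j ℕ.+ r)) (qj-mono c≥1 j)
  where
  open EventuallyPeriodic c r s periodic
  open CharacteristicRoots (tα c r s) ((ℤ.- + 1) ℤ.^ s)
  0<Δ : + 0 ℤ.< Δ
  0<Δ = discriminant-positive 1≤s c≥1
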